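{- For every integer $k \ge 3$ there exists an infinite, locally finite, connected graph $\Gamma$ that is not $k$-distinguishable (indeed $D(\Gamma) = k+1$) but such that, for every vertex $x \in V\Gamma$, all but finitely many of the ball-graphs $B(x,n)$, $n\in\mathbb{N}$, have distinguishing number exactly $k$. In particular, for locally finite connected graphs the lower bound $k$ on the distinguishing number of the ball-graphs in the statement "if $\Gamma$ is not $k$-distinguishable then all but finitely many ball-graphs centered at any vertex have distinguishing number at least $k$" cannot be improved.
   Context: For a group $G$ acting faithfully on a set $V$, $(G,V)$ is $k$-distinguishable if there is a partition of $V$ into $k$ cells such that only the identity of $G$ fixes every cell setwise. The distinguishing number $D(G,V)$ is the least cardinal $k$ such that $(G,V)$ is $k$-distinguishable. For a graph $\Lambda$, $D(\Lambda) := D(\mathrm{Aut}(\Lambda), V\Lambda)$, and $\Lambda$ is $k$-distinguishable if $D(\Lambda) \le k$. For $x \in V\Gamma$ and $n \in \mathbb{N}$, the ball-graph $B(x,n)$ is the subgraph of $\Gamma$ induced by $\{y \in V\Gamma : d(x,y) \le n\}$, where $d$ is the graph distance; its distinguishing number is that of the graph $B(x,n)$ with its own full automorphism group. -}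

module Defs where

open import Data.Nat using (ℕ; zero; suc; _≤_)
open import Data.Fin using (Fin)
open import Data.List using (List)
open import Data.List.Relation.Unary.Any using (Any)
open import Data.Product using (Σ; _×_; _,_; proj₁; proj₂)
open import Data.Empty using (⊥)
open import Relation.Nullary using (¬_)
open import Relation.Binary.PropositionalEquality using (_≡_)
open import Relation.Binary.Structures using (IsEquivalence)

record Graph : Set₁ where
  field
    V          : Set
    _≈_        : V → V → Set
    isEquiv    : IsEquivalence _≈_
    Adj        : V → V → Set
    Adj-resp   : ∀ {u u′ v v′} → u ≈ u′ → v ≈ v′ → Adj u v → Adj u′ v′
    Adj-sym    : ∀ {u v} → Adj u v → Adj v u
    Adj-irrefl : ∀ {u v} → u ≈ v → ¬ Adj u v

open Graph public

record Aut (G : Graph) : Set where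
  field
    fun     : V G → V G
    inv     : V G → V G
    fun-cong : ∀ {u v} → _≈_ G u v → _≈_ G (fun u) (fun v)
    inv-cong : ∀ {u v} → _≈_ G u v → _≈_ G (inv u) (inv v)
    fun-inv : ∀ v → _≈_ G (fun (inv v)) v
    inv-fun : ∀ v → _≈_ G (inv (fun v)) v
    adj-pres : ∀ u v → Adj G u v → Adj G (fun u) (fun v)
    adj-refl : ∀ u v → Adj G (fun u) (fun v) → Adj G u v

open Aut public

-- A partition of V into k (possibly empty) cells, given by a colouring
-- respecting vertex equality; an automorphism fixes every cell setwise
-- iff it preserves the colouring.
Distinguishable : Graph → ℕ → Set
Distinguishable G k =
  Σ (V G → Fin k) λ c →
    (∀ {u v} → _≈_ G u v → c u ≡ c v) ×
    ((σ : Aut G) → (∀ v → c (fun σ v) ≡ c v) → ∀ v → _≈_ G (fun σ v) v)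

HasDistinguishingNumber : Graph → ℕ → Set
HasDistinguishingNumber G m =
  Distinguishable G m × (∀ j → Distinguishable G j → m ≤ j)

WalkLen : (G : Graph) → V G → V G → ℕ → Set
WalkLen G u v zero = _≈_ G u v
WalkLen G u v (suc n) = Σ (V G) λ w → Adj G u w × WalkLen G w v n

DistLE : (G : Graph) → V G → V G → ℕ → Set
DistLE G x y n = Σ ℕ λ m → m ≤ n × WalkLen G x y m

Connected : Graph → Set
Connected G = ∀ u v → Σ ℕ λ n → WalkLen G u v n

Infinite : Graph → Set
Infinite G = ¬ (Σ (List (V G)) λ l → ∀ v → Any (_≈_ G v) l)

LocallyFinite : Graph → Set
LocallyFinite G = ∀ v → Σ (List (V G)) λ l →
  ∀ w → (Adj G v w → Any (_≈_ G w) l) × (Any (_≈_ G w) l → Adj G v w)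

Ball : (G : Graph) → V G → ℕ → Graph
Ball G x n = record
  { V = Σ (V G) λ y → DistLE G x y n
  ; _≈_ = λ a b → _≈_ G (proj₁ a) (proj₁ b)
  ; isEquiv = record
      { refl = IsEquivalence.refl (isEquiv G)
      ; sym = IsEquivalence.sym (isEquiv G)
      ; trans = IsEquivalence.trans (isEquiv G) }
  ; Adj = λ a b → Adj G (proj₁ a) (proj₁ b)
  ; Adj-resp = Adj-resp G
  ; Adj-sym = Adj-sym G
  ; Adj-irrefl = Adj-irrefl G
  }

-- For k ≥ 2 (in particular k ≥ 3) let lab : ℤ → Bool have pattern T T F F
-- (period 4, lab (j+2) = not (lab j)), and let Γ have vertex set ℤ × Fin k,
-- consecutive layers {j} × Fin k completely joined, layer j a clique iff lab j.
-- Vertices of a layer are twins, so layer transpositions are automorphisms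
-- and any distinguishing colouring is injective on layers (≥ k colours).
-- General facts on twins and distinguishing numbers come first; then, for
-- "layered views" (graphs spanned by whole layers of Γ: Γ and its balls),
-- twin classes are layers, automorphisms keep layer labels, and a fixed
-- layer forces its neighbours fixed since lab (j+1) ≠ lab (j-1).  For Γ,
-- translation by 4 survives every k-colouring while one extra colour on
-- layer 0 pins everything: D(Γ) = k + 1.  For n ≥ 2, B(x,n) is the window
-- of layers i-n … i+n; automorphisms send its end layer to an end, labels
-- near the two ends forbid reversal, so colouring by index distinguishes:
-- D(B(x,n)) = k.
module Submission where

open import Defs
open import Data.Nat as ℕ using (ℕ; zero; suc; _≤_; s≤s; z≤n)
import Data.Nat.Properties as ℕP
import Data.Nat.Tactic.RingSolver as ℕSolver
open import Data.Integer as ℤ using (ℤ; +_; -[1+_]; 0ℤ; 1ℤ; -1ℤ)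
  renaming (suc to sucℤ; pred to predℤ)
import Data.Integer.Properties as ℤP
open import Data.Integer.Tactic.RingSolver using (solve-∀)
open import Data.Fin as F using (Fin)
import Data.Fin.Properties as FP
open import Data.Fin.Permutation using (Permutation′; _⟨$⟩ʳ_; _⟨$⟩ˡ_; inverseˡ; inverseʳ; transpose)
import Data.Fin.Permutation as Perm
import Data.Fin.Permutation.Components as Transposition
open import Data.Bool using (Bool; true; false; not)
import Data.Bool as Bool
open import Data.List using (List; []; _∷_; filter; allFin; cartesianProduct)
open import Data.List.Relation.Unary.Any using (Any; here; there)
open import Data.List.Membership.Propositional using (_∈_)
open import Data.List.Membership.Propositional.Properties
  using (∈-filter⁺; ∈-filter⁻; ∈-allFin; ∈-cartesianProduct⁺)
open import Data.Product using (Σ; _×_; _,_; proj₁; proj₂)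
import Data.Product as Product
open import Data.Sum using (_⊎_; inj₁; inj₂)
import Data.Sum as Sum
open import Data.Unit using (⊤; tt)
open import Data.Empty using (⊥-elim)
open import Function.Definitions using (Injective)
open import Relation.Nullary using (¬_; ¬?; Dec; yes; no)
open import Relation.Nullary.Decidable using (_⊎-dec_; _×-dec_)
open import Relation.Binary.Structures using (IsEquivalence)
open import Relation.Binary.Definitions using (tri<; tri≈; tri>)
open import Relation.Binary.PropositionalEquality

-- lab j says whether layer j is a clique: pattern T T F F with period 4,
-- written separately on the non-negative and the negative integers.
labℕ : ℕ → Bool
labℕ 0 = true
labℕ 1 = true
labℕ 2 = false
labℕ 3 = false
labℕ (suc (suc (suc (suc n)))) = labℕ n

-- labNeg n is the label of -(n + 1).
labNeg : ℕ → Bool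
labNeg 0 = false
labNeg 1 = false
labNeg 2 = true
labNeg 3 = true
labNeg (suc (suc (suc (suc n)))) = labNeg n

lab : ℤ → Bool
lab (+ n) = labℕ n
lab -[1+ n ] = labNeg n

lab-+2 : ∀ j → lab (+ 2 ℤ.+ j) ≡ not (lab j)
lab-+2 (+ n) = labℕ-+2 n
  where
  labℕ-+2 : ∀ n → labℕ (suc (suc n)) ≡ not (labℕ n)
  labℕ-+2 0 = refl
  labℕ-+2 1 = refl
  labℕ-+2 2 = refl
  labℕ-+2 3 = refl
  labℕ-+2 (suc (suc (suc (suc n)))) = labℕ-+2 n
lab-+2 -[1+ 0 ] = refl
lab-+2 -[1+ 1 ] = refl
lab-+2 -[1+ suc (suc n) ] = labNeg-+2 n
  where
  labNeg-+2 : ∀ n → labNeg n ≡ not (labNeg (suc (suc n)))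
  labNeg-+2 0 = refl
  labNeg-+2 1 = refl
  labNeg-+2 2 = refl
  labNeg-+2 3 = refl
  labNeg-+2 (suc (suc (suc (suc n)))) = labNeg-+2 n

not≢ : ∀ b → not b ≢ b
not≢ true ()
not≢ false ()

not-involutive : ∀ b → not (not b) ≡ b
not-involutive true = refl
not-involutive false = refl

lab-+4 : ∀ j → lab (+ 4 ℤ.+ j) ≡ lab j
lab-+4 j = begin
  lab (+ 4 ℤ.+ j)               ≡⟨ cong lab (split j) ⟩
  lab (+ 2 ℤ.+ (+ 2 ℤ.+ j))     ≡⟨ lab-+2 (+ 2 ℤ.+ j) ⟩
  not (lab (+ 2 ℤ.+ j))         ≡⟨ cong not (lab-+2 j) ⟩
  not (not (lab j))             ≡⟨ not-involutive (lab j) ⟩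
  lab j                         ∎
  where
  open ≡-Reasoning
  split : ∀ x → + 4 ℤ.+ x ≡ + 2 ℤ.+ (+ 2 ℤ.+ x)
  split = solve-∀

lab-+4m+2 : ∀ m X → lab (X ℤ.+ + (suc (suc (m ℕ.* 4)))) ≡ not (lab X)
lab-+4m+2 zero X = trans (cong lab (ℤP.+-comm X (+ 2))) (lab-+2 X)
lab-+4m+2 (suc m) X =
  trans (cong lab (shift X (+ (m ℕ.* 4))))
        (trans (lab-+4 (X ℤ.+ + (suc (suc (m ℕ.* 4))))) (lab-+4m+2 m X))
  where
  shift : ∀ X Q → X ℤ.+ (1ℤ ℤ.+ (1ℤ ℤ.+ (1ℤ ℤ.+ (1ℤ ℤ.+ (1ℤ ℤ.+ (1ℤ ℤ.+ Q))))))
                ≡ + 4 ℤ.+ (X ℤ.+ (1ℤ ℤ.+ (1ℤ ℤ.+ Q)))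
  shift = solve-∀

-- The two neighbours of any layer have different labels: this is what
-- lets a fixed layer force its neighbours to be fixed.
lab-neighbours : ∀ j → lab (sucℤ j) ≢ lab (predℤ j)
lab-neighbours j e = not≢ (lab (predℤ j))
  (trans (sym (lab-+2 (predℤ j))) (trans (cong lab (two-up j)) e))
  where
  two-up : ∀ x → + 2 ℤ.+ (-1ℤ ℤ.+ x) ≡ 1ℤ ℤ.+ x
  two-up = solve-∀

diff≢ : ∀ {a b} c → a ℤ.- b ≡ c → c ≢ 0ℤ → a ≢ b
diff≢ {a} {b} c p c≢0 a≡b =
  c≢0 (trans (sym p) (trans (cong (ℤ._- b) a≡b) (ℤP.+-inverseʳ b)))

suc-i≢pred-i : ∀ {i} → sucℤ i ≢ predℤ i
suc-i≢pred-i {i} = diff≢ (+ 2) (gap i) (λ ())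
  where
  gap : ∀ x → (1ℤ ℤ.+ x) ℤ.- (-1ℤ ℤ.+ x) ≡ + 2
  gap = solve-∀

pred-i≢i+2 : ∀ i → predℤ i ≢ sucℤ (sucℤ i)
pred-i≢i+2 i = diff≢ (-[1+ 2 ]) (gap i) (λ ())
  where
  gap : ∀ x → (-1ℤ ℤ.+ x) ℤ.- (1ℤ ℤ.+ (1ℤ ℤ.+ x)) ≡ -[1+ 2 ]
  gap = solve-∀

pred-i≢i+3 : ∀ i → predℤ i ≢ sucℤ (sucℤ (sucℤ i))
pred-i≢i+3 i = diff≢ (-[1+ 3 ]) (gap i) (λ ())
  where
  gap : ∀ x → (-1ℤ ℤ.+ x) ℤ.- (1ℤ ℤ.+ (1ℤ ℤ.+ (1ℤ ℤ.+ x))) ≡ -[1+ 3 ]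
  gap = solve-∀

pred-i≢i : ∀ {i} → predℤ i ≢ i
pred-i≢i {i} e = ℤP.i≢suc[i] (trans (sym (ℤP.suc-pred i)) (cong sucℤ e))

sucℤ-injective : ∀ {i j} → sucℤ i ≡ sucℤ j → i ≡ j
sucℤ-injective {i} {j} e = trans (sym (ℤP.pred-suc i)) (trans (cong predℤ e) (ℤP.pred-suc j))

+-cancelˡ : ∀ {x a b : ℤ} → x ℤ.+ a ≡ x ℤ.+ b → a ≡ b
+-cancelˡ {x} {a} {b} e = trans (sym (cancel x a)) (trans (cong (λ z → ℤ.- x ℤ.+ z) e) (cancel x b))
  where
  cancel : ∀ x a → ℤ.- x ℤ.+ (x ℤ.+ a) ≡ a
  cancel = solve-∀

ℤ-induction : ∀ (P : ℤ → Set) → P 0ℤ → (∀ j → P j → P (sucℤ j)) → (∀ j → P j → P (predℤ j)) →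
              ∀ j → P j
ℤ-induction P p0 up down (+ zero) = p0
ℤ-induction P p0 up down (+ suc n) = up (+ n) (ℤ-induction P p0 up down (+ n))
ℤ-induction P p0 up down -[1+ zero ] = down 0ℤ p0
ℤ-induction P p0 up down -[1+ suc n ] = down -[1+ n ] (ℤ-induction P p0 up down -[1+ n ])

shift unshift : ℤ → ℤ
shift j = + 4 ℤ.+ j
unshift j = -[1+ 3 ] ℤ.+ j

shift-unshift : ∀ j → + 4 ℤ.+ (-[1+ 3 ] ℤ.+ j) ≡ j
shift-unshift = solve-∀

unshift-shift : ∀ j → -[1+ 3 ] ℤ.+ (+ 4 ℤ.+ j) ≡ j
unshift-shift = solve-∀

shift-suc : ∀ j → + 4 ℤ.+ (1ℤ ℤ.+ j) ≡ 1ℤ ℤ.+ (+ 4 ℤ.+ j)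
shift-suc = solve-∀

shift-injective : ∀ {x y} → shift x ≡ shift y → x ≡ y
shift-injective {x} {y} e = trans (sym (unshift-shift x)) (trans (cong unshift e) (unshift-shift y))

bool-ext : ∀ {a b : Bool} → (a ≡ true → b ≡ true) → (b ≡ true → a ≡ true) → a ≡ b
bool-ext {true} {true} f g = refl
bool-ext {true} {false} f g = sym (f refl)
bool-ext {false} {true} f g = g refl
bool-ext {false} {false} f g = refl

parity : ∀ n → Σ ℕ λ m → n ≡ m ℕ.+ m ⊎ n ≡ suc (m ℕ.+ m)
parity zero = 0 , inj₁ refl
parity (suc n) with parity n
... | m , inj₁ even = m , inj₂ (cong suc even)
... | m , inj₂ odd = suc m , inj₁ (cong suc (trans odd (sym (ℕP.+-suc m m))))

AdjPath : ℕ → ℕ → Set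
AdjPath s t = s ≡ suc t ⊎ t ≡ suc s

SeparatesPath : ℕ → ℕ → ℕ → Set
SeparatesPath s t t′ = (AdjPath s t × ¬ AdjPath s t′) ⊎ (AdjPath s t′ × ¬ AdjPath s t)

PathSeparator : ℕ → ℕ → ℕ → Set
PathSeparator N t t′ = Σ ℕ λ s → s ≤ N × s ≢ t × s ≢ t′ × SeparatesPath s t t′

below : ∀ n m → m ≢ suc (n ℕ.+ m)
below n m = ℕP.m≢1+n+m m

-- For t < t′ = 1 + d + t in a path with at least 5 vertices: t + 1
-- separates if d ≥ 2; otherwise t - 1, or t′ + 1 when t = 0.
path-separated< : ∀ N → 4 ≤ N → ∀ t d → suc d ℕ.+ t ≤ N → PathSeparator N t (suc d ℕ.+ t)
path-separated< N 4≤N t (suc (suc d)) le =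
  suc t , ℕP.≤-trans (s≤s (ℕP.m≤n+m t _)) le , ℕP.1+n≢n ,
  (λ e → below (1 ℕ.+ d) t (ℕP.suc-injective e)) ,
  inj₁ (inj₁ refl , λ
    { (inj₁ e) → below (2 ℕ.+ d) t (ℕP.suc-injective e)
    ; (inj₂ e) → below d t (sym (ℕP.suc-injective (ℕP.suc-injective e))) })
path-separated< N 4≤N (suc t) zero le =
  t , ℕP.≤-trans (ℕP.m≤n+m t 2) le , below 0 t ,
  below 1 t ,
  inj₁ (inj₂ refl , λ
    { (inj₁ e) → below 2 t e
    ; (inj₂ e) → ℕP.1+n≢n e })
path-separated< N 4≤N (suc t) (suc zero) le =
  t , ℕP.≤-trans (ℕP.m≤n+m t 3) le , below 0 t ,
  below 2 t ,
  inj₁ (inj₂ refl , λ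
    { (inj₁ e) → below 3 t e
    ; (inj₂ e) → below 1 t (sym (ℕP.suc-injective e)) })
path-separated< N 4≤N zero zero le =
  2 , ℕP.≤-trans (s≤s (s≤s z≤n)) 4≤N , (λ ()) , (λ ()) , inj₂ (inj₁ refl , λ { (inj₁ ()) ; (inj₂ ()) })
path-separated< N 4≤N zero (suc zero) le =
  3 , ℕP.≤-trans (s≤s (s≤s (s≤s z≤n))) 4≤N , (λ ()) , (λ ()) , inj₂ (inj₁ refl , λ { (inj₁ ()) ; (inj₂ ()) })

path-separated-ordered : ∀ N → 4 ≤ N → ∀ t t′ → t ℕ.< t′ → t′ ≤ N → PathSeparator N t t′
path-separated-ordered N 4≤N t t′ t<t′ t′≤N with ℕP.m≤n⇒∃[o]m+o≡n t<t′
... | d , refl = subst (λ z → PathSeparator N t (suc z)) (ℕP.+-comm d t)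
                   (path-separated< N 4≤N t d (subst (λ z → suc z ≤ N) (ℕP.+-comm t d) t′≤N))

path-separated : ∀ N → 4 ≤ N → ∀ t t′ → t ≤ N → t′ ≤ N → t ≢ t′ → PathSeparator N t t′
path-separated N 4≤N t t′ t≤N t′≤N t≢t′ with ℕP.<-cmp t t′
... | tri< t<t′ _ _ = path-separated-ordered N 4≤N t t′ t<t′ t′≤N
... | tri≈ _ t≡t′ _ = ⊥-elim (t≢t′ t≡t′)
... | tri> _ _ t′<t with path-separated-ordered N 4≤N t′ t t′<t t≤N
...   | s , s≤N , s≢t′ , s≢t , sep = s , s≤N , s≢t , s≢t′ , Sum.swap sep

module GraphFacts (G : Graph) where
  open IsEquivalence (isEquiv G) renaming (refl to ≈-refl; sym to ≈-sym; trans to ≈-trans)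

  _≈G_ : V G → V G → Set
  _≈G_ = _≈_ G

  aut-injective : (σ : Aut G) → ∀ {u v} → fun σ u ≈G fun σ v → u ≈G v
  aut-injective σ e = ≈-trans (≈-sym (inv-fun σ _)) (≈-trans (inv-cong σ e) (inv-fun σ _))

  adj-inv : (σ : Aut G) → ∀ {u w} → Adj G (fun σ u) w → Adj G u (inv σ w)
  adj-inv σ a = adj-refl σ _ _ (Adj-resp G ≈-refl (≈-sym (fun-inv σ _)) a)

  adj-fun : (σ : Aut G) → ∀ {u w} → Adj G u (inv σ w) → Adj G (fun σ u) w
  adj-fun σ a = Adj-resp G ≈-refl (fun-inv σ _) (adj-pres σ _ _ a)

  Twins : V G → V G → Set
  Twins u v = ∀ w → ¬ (w ≈G u) → ¬ (w ≈G v) →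
              (Adj G u w → Adj G v w) × (Adj G v w → Adj G u w)

  twins-preserved : (σ : Aut G) → ∀ {u v} → Twins u v → Twins (fun σ u) (fun σ v)
  twins-preserved σ {u} {v} t w w≉σu w≉σv =
    (λ a → adj-fun σ (proj₁ (t (inv σ w) w′≉u w′≉v) (adj-inv σ a))) ,
    (λ a → adj-fun σ (proj₂ (t (inv σ w) w′≉u w′≉v) (adj-inv σ a)))
    where
    w′≉u : ¬ (inv σ w ≈G u)
    w′≉u e = w≉σu (≈-trans (≈-sym (fun-inv σ w)) (fun-cong σ e))
    w′≉v : ¬ (inv σ w ≈G v)
    w′≉v e = w≉σv (≈-trans (≈-sym (fun-inv σ w)) (fun-cong σ e))

  twins-sym : ∀ {u v} → Twins u v → Twins v u
  twins-sym t w n1 n2 = Product.swap (t w n2 n1)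

  twins-resp : ∀ {u u′ v v′} → u ≈G u′ → v ≈G v′ → Twins u v → Twins u′ v′
  twins-resp {u} {u′} {v} {v′} eu ev t w n1 n2 =
    (λ a → Adj-resp G ev ≈-refl (proj₁ t′ (Adj-resp G (≈-sym eu) ≈-refl a))) ,
    (λ a → Adj-resp G eu ≈-refl (proj₂ t′ (Adj-resp G (≈-sym ev) ≈-refl a)))
    where
    t′ : (Adj G u w → Adj G v w) × (Adj G v w → Adj G u w)
    t′ = t w (λ e → n1 (≈-trans e eu)) (λ e → n2 (≈-trans e ev))

distinguishable-mono : ∀ {G j m} → Distinguishable G j → j ≤ m → Distinguishable G m
distinguishable-mono (c , c-cong , rigid) le =
  (λ v → F.inject≤ (c v) le) ,
  (λ e → cong (λ z → F.inject≤ z le) (c-cong e)) ,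
  λ σ pres → rigid σ (λ v → FP.inject≤-injective le le _ _ (pres v))

distinguishing-number : ∀ {G m} → Distinguishable G (suc m) → ¬ Distinguishable G m →
                        HasDistinguishingNumber G (suc m)
distinguishing-number {G} {m} D ¬D = D , least
  where
  least : ∀ j → Distinguishable G j → suc m ≤ j
  least j Dj with suc m ℕ.≤? j
  ... | yes le = le
  ... | no ¬le = ⊥-elim (¬D (distinguishable-mono Dj (ℕP.≤-pred (ℕP.≰⇒> ¬le))))

injective-endo-onto : ∀ {n} (f : Fin n → Fin n) → Injective _≡_ _≡_ f →
                      ∀ y → Σ (Fin n) λ a → f a ≡ y
injective-endo-onto {suc m} f f-inj y with FP.any? (λ a → f a F.≟ y)
... | yes found = found
... | no missed = ⊥-elim (ℕP.1+n≰n (FP.injective⇒≤ punched-injective))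
  where
  punched : Fin (suc m) → Fin m
  punched a = F.punchOut {i = y} {j = f a} (λ e → missed (a , sym e))
  punched-injective : Injective _≡_ _≡_ punched
  punched-injective {a} {b} e =
    f-inj (FP.punchOut-injective {i = y} (λ e′ → missed (a , sym e′)) (λ e′ → missed (b , sym e′)) e)

module Construction (k′ : ℕ) where
  k : ℕ
  k = suc (suc k′)

  other : Fin k → Fin k
  other F.zero = F.suc F.zero
  other (F.suc _) = F.zero

  other≢ : ∀ a → a ≢ other a
  other≢ F.zero ()
  other≢ (F.suc _) ()

  LAdj : ℤ → Fin k → ℤ → Fin k → Set
  LAdj i a j b = (j ≡ sucℤ i) ⊎ (i ≡ sucℤ j) ⊎ (i ≡ j × a ≢ b × lab i ≡ true)

  LAdj-sym : ∀ {i a j b} → LAdj i a j b → LAdj j b i a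
  LAdj-sym (inj₁ p) = inj₂ (inj₁ p)
  LAdj-sym (inj₂ (inj₁ p)) = inj₁ p
  LAdj-sym (inj₂ (inj₂ (p , a≢b , clique))) =
    inj₂ (inj₂ (sym p , (λ e → a≢b (sym e)) , subst (λ x → lab x ≡ true) p clique))

  Γ : Graph
  Γ = record
    { V = ℤ × Fin k
    ; _≈_ = _≡_
    ; isEquiv = isEquivalence
    ; Adj = λ u v → LAdj (proj₁ u) (proj₂ u) (proj₁ v) (proj₂ v)
    ; Adj-resp = λ { refl refl a → a }
    ; Adj-sym = LAdj-sym
    ; Adj-irrefl = irreflexive
    }
    where
    irreflexive : ∀ {u v : ℤ × Fin k} → u ≡ v → ¬ LAdj (proj₁ u) (proj₂ u) (proj₁ v) (proj₂ v)
    irreflexive refl (inj₁ p) = ℤP.i≢suc[i] p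
    irreflexive refl (inj₂ (inj₁ p)) = ℤP.i≢suc[i] p
    irreflexive refl (inj₂ (inj₂ (_ , a≢a , _))) = a≢a refl

  LayerAdj : ℤ → ℤ → Set
  LayerAdj l j = (l ≡ sucℤ j) ⊎ (j ≡ sucℤ l)

  LayerAdj-sym : ∀ {l j} → LayerAdj l j → LayerAdj j l
  LayerAdj-sym = Sum.swap

  LayerAdj-irrefl : ∀ {l j} → LayerAdj l j → l ≢ j
  LayerAdj-irrefl (inj₁ p) e = ℤP.i≢suc[i] (trans (sym e) p)
  LayerAdj-irrefl (inj₂ p) e = ℤP.i≢suc[i] (trans e p)

  LayerAdj⇒LAdj : ∀ {i a j b} → LayerAdj j i → LAdj i a j b
  LayerAdj⇒LAdj (inj₁ p) = inj₁ p
  LayerAdj⇒LAdj (inj₂ p) = inj₂ (inj₁ p)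

  LAdj⇒LayerAdj : ∀ {i a j b} → i ≢ j → LAdj i a j b → LayerAdj j i
  LAdj⇒LayerAdj i≢j (inj₁ p) = inj₁ p
  LAdj⇒LayerAdj i≢j (inj₂ (inj₁ p)) = inj₂ p
  LAdj⇒LayerAdj i≢j (inj₂ (inj₂ (p , _))) = ⊥-elim (i≢j p)

  LayerAdj-cases : ∀ {l j} → LayerAdj l j → l ≡ sucℤ j ⊎ l ≡ predℤ j
  LayerAdj-cases (inj₁ p) = inj₁ p
  LayerAdj-cases {l} (inj₂ p) = inj₂ (trans (sym (ℤP.pred-suc l)) (cong predℤ (sym p)))

  LAdj-map : ∀ {i a j b i′ a′ j′ b′} → i′ ≡ i → j′ ≡ j → (i ≡ j → a ≢ b → a′ ≢ b′) →
             LAdj i a j b → LAdj i′ a′ j′ b′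
  LAdj-map e1 e2 f (inj₁ p) = inj₁ (trans e2 (trans p (cong sucℤ (sym e1))))
  LAdj-map e1 e2 f (inj₂ (inj₁ p)) = inj₂ (inj₁ (trans e1 (trans p (cong sucℤ (sym e2)))))
  LAdj-map e1 e2 f (inj₂ (inj₂ (p , q , r))) =
    inj₂ (inj₂ (trans e1 (trans p (sym e2)) , f p q , subst (λ x → lab x ≡ true) (sym e1) r))

  -- A layered view of G: G is (isomorphic to) the induced subgraph of Γ
  -- on the layers j with In j, every such layer being present in full.
  record LayeredView (G : Graph) : Set₁ where
    field
      In     : ℤ → Set
      lay    : V G → ℤ
      idx    : V G → Fin k
      lay-In : ∀ u → In (lay u)
      vertex : ∀ j → In j → Fin k → V G
      lay-vertex : ∀ j p a → lay (vertex j p a) ≡ j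
      idx-vertex : ∀ j p a → idx (vertex j p a) ≡ a
      ≈⇒lay  : ∀ {u v} → _≈_ G u v → lay u ≡ lay v
      ≈⇒idx  : ∀ {u v} → _≈_ G u v → idx u ≡ idx v
      coords⇒≈ : ∀ {u v} → lay u ≡ lay v → idx u ≡ idx v → _≈_ G u v
      adj⇒LAdj : ∀ {u v} → Adj G u v → LAdj (lay u) (idx u) (lay v) (idx v)
      LAdj⇒adj : ∀ {u v} → LAdj (lay u) (idx u) (lay v) (idx v) → Adj G u v

  module Layered {G : Graph} (L : LayeredView G) where
    open LayeredView L
    open GraphFacts G
    open IsEquivalence (isEquiv G) renaming (refl to ≈-refl; sym to ≈-sym; trans to ≈-trans)

    -- Any two distinct present layers are told apart by a third present
    -- layer adjacent to exactly one of them.  Under this hypothesis the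
    -- twin classes are exactly the layers.
    Separated : Set
    Separated = ∀ j j′ → In j → In j′ → j ≢ j′ →
      Σ ℤ λ l → In l × l ≢ j × l ≢ j′ ×
        ((LayerAdj l j × ¬ LayerAdj l j′) ⊎ (LayerAdj l j′ × ¬ LayerAdj l j))

    same-layer⇒twins : ∀ {u v} → lay u ≡ lay v → Twins u v
    same-layer⇒twins {u} {v} e w w≉u w≉v =
      (λ a → LAdj⇒adj (move e w≉v (adj⇒LAdj a))) ,
      (λ a → LAdj⇒adj (move (sym e) w≉u (adj⇒LAdj a)))
      where
      move : ∀ {u v w} → lay u ≡ lay v → ¬ (w ≈G v) →
             LAdj (lay u) (idx u) (lay w) (idx w) → LAdj (lay v) (idx v) (lay w) (idx w)
      move e n (inj₁ p) = inj₁ (trans p (cong sucℤ e))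
      move e n (inj₂ (inj₁ p)) = inj₂ (inj₁ (trans (sym e) p))
      move e n (inj₂ (inj₂ (p , _ , r))) =
        inj₂ (inj₂ (trans (sym e) p ,
                    (λ ie → n (coords⇒≈ (sym (trans (sym e) p)) (sym ie))) ,
                    subst (λ x → lab x ≡ true) e r))

    separated-not-twins : ∀ {u v l} → In l → l ≢ lay u → l ≢ lay v →
                          LayerAdj l (lay u) → ¬ LayerAdj l (lay v) → ¬ Twins u v
    separated-not-twins {u} {v} {l} p l≢u l≢v adj-u ¬adj-v t =
      ¬adj-v (subst (λ z → LayerAdj z (lay v)) lay-w
               (LAdj⇒LayerAdj (λ e → l≢v (trans (sym lay-w) (sym e))) (adj⇒LAdj (proj₁ (t w w≉u w≉v) u~w))))
      where
      w : V G
      w = vertex l p F.zero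
      lay-w : lay w ≡ l
      lay-w = lay-vertex l p F.zero
      w≉u : ¬ (w ≈G u)
      w≉u e = l≢u (trans (sym lay-w) (≈⇒lay e))
      w≉v : ¬ (w ≈G v)
      w≉v e = l≢v (trans (sym lay-w) (≈⇒lay e))
      u~w : Adj G u w
      u~w = LAdj⇒adj (LayerAdj⇒LAdj (subst (λ z → LayerAdj z (lay u)) (sym lay-w) adj-u))

    twins⇒same-layer : Separated → ∀ {u v} → Twins u v → lay u ≡ lay v
    twins⇒same-layer sep {u} {v} t with lay u ℤ.≟ lay v
    ... | yes e = e
    ... | no ne with sep (lay u) (lay v) (lay-In u) (lay-In v) ne
    ... | l , p , l≢u , l≢v , inj₁ (adj-u , ¬adj-v) = ⊥-elim (separated-not-twins p l≢u l≢v adj-u ¬adj-v t)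
    ... | l , p , l≢u , l≢v , inj₂ (adj-v , ¬adj-u) =
      ⊥-elim (separated-not-twins p l≢v l≢u adj-v ¬adj-u (twins-sym t))

    same-layer-adj⇒clique : ∀ {u v} → lay u ≡ lay v → Adj G u v → lab (lay u) ≡ true
    same-layer-adj⇒clique e a with adj⇒LAdj a
    ... | inj₁ p = ⊥-elim (ℤP.i≢suc[i] (trans e p))
    ... | inj₂ (inj₁ p) = ⊥-elim (ℤP.i≢suc[i] (trans (sym e) p))
    ... | inj₂ (inj₂ (_ , _ , clique)) = clique

    clique⇒same-layer-adj : ∀ {u v} → lay u ≡ lay v → idx u ≢ idx v → lab (lay u) ≡ true → Adj G u v
    clique⇒same-layer-adj e ne clique = LAdj⇒adj (inj₂ (inj₂ (e , ne , clique)))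

    label-preserved : (σ : Aut G) → ∀ {u u′} → lay u ≡ lay u′ → idx u ≢ idx u′ →
                      lay (fun σ u) ≡ lay (fun σ u′) → lab (lay u) ≡ lab (lay (fun σ u))
    label-preserved σ {u} {u′} e ne e′ = bool-ext
      (λ clique → same-layer-adj⇒clique e′ (adj-pres σ u u′ (clique⇒same-layer-adj e ne clique)))
      (λ clique → same-layer-adj⇒clique e (adj-refl σ u u′ (clique⇒same-layer-adj e′ ne′ clique)))
      where
      ne′ : idx (fun σ u) ≢ idx (fun σ u′)
      ne′ ie = ne (≈⇒idx (aut-injective σ (coords⇒≈ e′ ie)))

    module _ (σ : Aut G) where
      MapsOnto : ℤ → ℤ → Set
      MapsOnto j j′ = ∀ (q : In j′) a → Σ (V G) λ y → lay y ≡ j × fun σ y ≈G vertex j′ q a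

      Fixed : ℤ → Set
      Fixed j = ∀ u → lay u ≡ j → fun σ u ≈G u

      fixed⇒maps-onto : ∀ {j} → Fixed j → MapsOnto j j
      fixed⇒maps-onto {j} fx q a = vertex j q a , lay-vertex j q a , fx (vertex j q a) (lay-vertex j q a)

      -- If σ maps layer j onto j′, a neighbour u of layer j outside it is
      -- sent next to layer j′ (not into j′, which is already taken).
      image-beside : ∀ {j j′} → MapsOnto j j′ → ∀ {u z} → lay u ≢ j → Adj G u z →
                     lay z ≡ j → lay (fun σ z) ≡ j′ → LayerAdj (lay (fun σ u)) j′
      image-beside {j} {j′} onto {u} {z} u∉j a lz lz′ with lay (fun σ u) ℤ.≟ lay (fun σ z)
      ... | no ne = subst (LayerAdj (lay (fun σ u))) lz′
                      (LayerAdj-sym (LAdj⇒LayerAdj ne (adj⇒LAdj (adj-pres σ u z a))))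
      ... | yes e = ⊥-elim (u∉j (trans (sym (≈⇒lay y≈u)) ly))
        where
        q : In j′
        q = subst In (trans e lz′) (lay-In (fun σ u))
        preimage : Σ (V G) λ y → lay y ≡ j × fun σ y ≈G vertex j′ q (idx (fun σ u))
        preimage = onto q (idx (fun σ u))
        y : V G
        y = proj₁ preimage
        ly : lay y ≡ j
        ly = proj₁ (proj₂ preimage)
        y≈u : y ≈G u
        y≈u = aut-injective σ (≈-trans (proj₂ (proj₂ preimage))
                (coords⇒≈ (trans (lay-vertex _ _ _) (sym (trans e lz′))) (idx-vertex _ _ _)))

      fixed-propagates :
        Separated → ∀ {m} (c : V G → Fin m) → (∀ v → c (fun σ v) ≡ c v) →
        (∀ {u v} → lay u ≡ lay v → c u ≡ c v → idx u ≡ idx v) →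
        ∀ {j j₁ j₂} → In j → LayerAdj j₁ j → lab j₁ ≢ lab j₂ →
        (∀ l → LayerAdj l j → l ≡ j₁ ⊎ l ≡ j₂) → Fixed j → Fixed j₁
      fixed-propagates sep c c-pres c-inj {j} {j₁} {j₂} pj j₁~j labs≢ nbrs fx u lu
        with nbrs _ (lands-beside-j u lu)
        where
        z : V G
        z = vertex j pj F.zero
        lz : lay z ≡ j
        lz = lay-vertex j pj F.zero
        lands-beside-j : ∀ v → lay v ≡ j₁ → LayerAdj (lay (fun σ v)) j
        lands-beside-j v lv =
          image-beside (fixed⇒maps-onto fx) (λ e → LayerAdj-irrefl j₁~j (trans (sym lv) e))
            (LAdj⇒adj (LayerAdj⇒LAdj (LayerAdj-sym (subst₂ LayerAdj (sym lv) (sym lz) j₁~j))))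
            lz (trans (≈⇒lay (fx z lz)) lz)
      ... | inj₁ e = coords⇒≈ (trans e (sym lu)) (c-inj (trans e (sym lu)) (c-pres u))
      ... | inj₂ e = ⊥-elim (labs≢ (trans (sym (cong lab lu)) (trans same-label (cong lab e))))
        where
        u′ : V G
        u′ = vertex j₁ (subst In lu (lay-In u)) (other (idx u))
        lu′ : lay u ≡ lay u′
        lu′ = trans lu (sym (lay-vertex _ _ _))
        same-label : lab (lay u) ≡ lab (lay (fun σ u))
        same-label = label-preserved σ lu′ (λ ie → other≢ (idx u) (trans ie (idx-vertex _ _ _)))
                       (twins⇒same-layer sep (twins-preserved σ (same-layer⇒twins lu′)))

    -- u is end-like: among any two neighbours w, w′ of u, two of u, w, w′
    -- are twins.  This is invariant under automorphisms, holds at an end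
    -- layer, and fails at an interior layer.
    EndLike : V G → Set
    EndLike u = ∀ w w′ → Adj G u w → Adj G u w′ → Twins w w′ ⊎ Twins u w ⊎ Twins u w′

    endLike-preserved : (σ : Aut G) → ∀ {u} → EndLike u → EndLike (fun σ u)
    endLike-preserved σ {u} eu w w′ a a′ with eu (inv σ w) (inv σ w′) (adj-inv σ a) (adj-inv σ a′)
    ... | inj₁ t = inj₁ (twins-resp (fun-inv σ w) (fun-inv σ w′) (twins-preserved σ t))
    ... | inj₂ (inj₁ t) = inj₂ (inj₁ (twins-resp ≈-refl (fun-inv σ w) (twins-preserved σ t)))
    ... | inj₂ (inj₂ t) = inj₂ (inj₂ (twins-resp ≈-refl (fun-inv σ w′) (twins-preserved σ t)))

    -- Without a layer below, all neighbours lie in lay u or lay u + 1.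
    bottom-endLike : ∀ {u} → ¬ In (predℤ (lay u)) → EndLike u
    bottom-endLike {u} no-below w w′ a a′ with neighbour-layer a | neighbour-layer a′
      where
      neighbour-layer : ∀ {w} → Adj G u w → lay w ≡ sucℤ (lay u) ⊎ lay w ≡ lay u
      neighbour-layer {w} a with adj⇒LAdj a
      ... | inj₁ p = inj₁ p
      ... | inj₂ (inj₁ p) =
        ⊥-elim (no-below (subst In (trans (sym (ℤP.pred-suc (lay w))) (cong predℤ (sym p))) (lay-In w)))
      ... | inj₂ (inj₂ (p , _)) = inj₂ (sym p)
    ... | inj₁ e | inj₁ e′ = inj₁ (same-layer⇒twins (trans e (sym e′)))
    ... | inj₂ e | _ = inj₂ (inj₁ (same-layer⇒twins (sym e)))
    ... | inj₁ _ | inj₂ e′ = inj₂ (inj₂ (same-layer⇒twins (sym e′)))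

    -- With layers j - 1 and j + 1 present, a vertex of layer j has
    -- neighbours below and above, no two of the three being twins.
    interior-not-endLike : Separated → ∀ {u j} → In (predℤ j) → In (sucℤ j) → lay u ≡ j → ¬ EndLike u
    interior-not-endLike sep {u} {j} below above lu eu with eu w w′ u~w u~w′
      where
      w w′ : V G
      w = vertex (predℤ j) below F.zero
      w′ = vertex (sucℤ j) above F.zero
      u~w : Adj G u w
      u~w = LAdj⇒adj (LayerAdj⇒LAdj (inj₂ (trans lu (trans (sym (ℤP.suc-pred j))
              (cong sucℤ (sym (lay-vertex _ _ _)))))))
      u~w′ : Adj G u w′
      u~w′ = LAdj⇒adj (LayerAdj⇒LAdj (inj₁ (trans (lay-vertex _ _ _) (cong sucℤ (sym lu)))))
    ... | inj₁ t = suc-i≢pred-i {j}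
            (sym (trans (sym (lay-vertex _ _ _)) (trans (twins⇒same-layer sep t) (lay-vertex _ _ _))))
    ... | inj₂ (inj₁ t) = pred-i≢i (sym (trans (sym lu) (trans (twins⇒same-layer sep t) (lay-vertex _ _ _))))
    ... | inj₂ (inj₂ t) = ℤP.i≢suc[i] (trans (sym lu) (trans (twins⇒same-layer sep t) (lay-vertex _ _ _)))

    reindex : (ℤ → Fin k → Fin k) → V G → V G
    reindex f u = vertex (lay u) (lay-In u) (f (lay u) (idx u))

    lay-reindex : ∀ f u → lay (reindex f u) ≡ lay u
    lay-reindex f u = lay-vertex _ _ _

    idx-reindex : ∀ f u → idx (reindex f u) ≡ f (lay u) (idx u)
    idx-reindex f u = idx-vertex _ _ _

    reindex-cong : ∀ f {u v} → u ≈G v → reindex f u ≈G reindex f v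
    reindex-cong f {u} {v} e = coords⇒≈ (trans (lay-reindex f u) (trans (≈⇒lay e) (sym (lay-reindex f v))))
      (trans (idx-reindex f u) (trans (cong₂ f (≈⇒lay e) (≈⇒idx e)) (sym (idx-reindex f v))))

    reindex-inverse : ∀ f g → (∀ l {x} → f l (g l x) ≡ x) → ∀ v → reindex f (reindex g v) ≈G v
    reindex-inverse f g fg v = coords⇒≈ (trans (lay-reindex f (reindex g v)) (lay-reindex g v))
      (trans (idx-reindex f _) (trans (cong₂ f (lay-reindex g v) (idx-reindex g v)) (fg (lay v))))

    layerwise : (ℤ → Permutation′ k) → Aut G
    layerwise π = record
      { fun = reindex fwd
      ; inv = reindex bwd
      ; fun-cong = reindex-cong fwd
      ; inv-cong = reindex-cong bwd
      ; fun-inv = reindex-inverse fwd bwd (λ l → inverseʳ (π l))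
      ; inv-fun = reindex-inverse bwd fwd (λ l → inverseˡ (π l))
      ; adj-pres = λ u v a → LAdj⇒adj (LAdj-map (lay-reindex fwd u) (lay-reindex fwd v)
          (λ e ne ie → ne (fwd-injective e (trans (sym (idx-reindex fwd u)) (trans ie (idx-reindex fwd v)))))
          (adj⇒LAdj a))
      ; adj-refl = λ u v a → LAdj⇒adj (LAdj-map (sym (lay-reindex fwd u)) (sym (lay-reindex fwd v))
          (λ e ne ie → ne (trans (idx-reindex fwd u)
                             (trans (cong₂ fwd (trans (sym (lay-reindex fwd u)) (trans e (lay-reindex fwd v))) ie)
                                    (sym (idx-reindex fwd v)))))
          (adj⇒LAdj a))
      }
      where
      fwd bwd : ℤ → Fin k → Fin k
      fwd l x = π l ⟨$⟩ʳ x
      bwd l x = π l ⟨$⟩ˡ x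
      fwd-injective : ∀ {u v} → lay u ≡ lay v → fwd (lay u) (idx u) ≡ fwd (lay v) (idx v) → idx u ≡ idx v
      fwd-injective {u} {v} e ie = begin
        idx u                                  ≡⟨ inverseˡ (π (lay u)) ⟨
        bwd (lay u) (fwd (lay u) (idx u))      ≡⟨ cong (bwd (lay u)) ie ⟩
        bwd (lay u) (fwd (lay v) (idx v))      ≡⟨ cong (λ l → bwd l (fwd (lay v) (idx v))) e ⟩
        bwd (lay v) (fwd (lay v) (idx v))      ≡⟨ inverseˡ (π (lay v)) ⟩
        idx v                                  ∎
        where open ≡-Reasoning

    swapAt : ℤ → Fin k → Fin k → ℤ → Permutation′ k
    swapAt j a b l with l ℤ.≟ j
    ... | yes _ = transpose a b
    ... | no _ = Perm.id

    swapAt-here : ∀ j a b x → swapAt j a b j ⟨$⟩ʳ x ≡ Transposition.transpose a b x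
    swapAt-here j a b x with j ℤ.≟ j
    ... | yes _ = refl
    ... | no j≢j = ⊥-elim (j≢j refl)

    swapAt-elsewhere : ∀ {j l} a b x → l ≢ j → swapAt j a b l ⟨$⟩ʳ x ≡ x
    swapAt-elsewhere {j} {l} a b x l≢j with l ℤ.≟ j
    ... | yes l≡j = ⊥-elim (l≢j l≡j)
    ... | no _ = refl

    TransposeCases : Fin k → Fin k → Fin k → Set
    TransposeCases a b x =
      (x ≡ a × Transposition.transpose a b x ≡ b) ⊎ (x ≡ b × Transposition.transpose a b x ≡ a) ⊎
      Transposition.transpose a b x ≡ x

    transpose-cases : ∀ a b x → TransposeCases a b x
    transpose-cases a b x with x F.≟ a
    ... | yes x≡a = inj₁ (x≡a , refl)
    ... | no _ with x F.≟ b
    ... | yes x≡b = inj₂ (inj₁ (x≡b , refl))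
    ... | no _ = inj₂ (inj₂ refl)

    transpose-moves : ∀ (a b : Fin k) → Transposition.transpose a b a ≡ b
    transpose-moves a b with a F.≟ a
    ... | yes _ = refl
    ... | no a≢a = ⊥-elim (a≢a refl)

    idx-swap : ∀ j a b u → lay u ≡ j →
               idx (fun (layerwise (swapAt j a b)) u) ≡ Transposition.transpose a b (idx u)
    idx-swap j a b u l≡j = trans (idx-vertex _ _ _)
      (trans (cong (λ l → swapAt j a b l ⟨$⟩ʳ idx u) l≡j) (swapAt-here j a b (idx u)))

    swap-preserves : ∀ {m} (c : V G → Fin m) → (∀ {u v} → u ≈G v → c u ≡ c v) →
                     ∀ j (q : In j) a b → c (vertex j q a) ≡ c (vertex j q b) →
                     ∀ u → c (fun (layerwise (swapAt j a b)) u) ≡ c u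
    swap-preserves c c-cong j q a b same u = by-layer (lay u ℤ.≟ j)
      where
      σu : V G
      σu = fun (layerwise (swapAt j a b)) u
      at-j : ∀ v {x} → lay v ≡ j → idx v ≡ x → c v ≡ c (vertex j q x)
      at-j v lv iv = c-cong (coords⇒≈ (trans lv (sym (lay-vertex _ _ _))) (trans iv (sym (idx-vertex _ _ _))))
      by-layer : Dec (lay u ≡ j) → c σu ≡ c u
      by-layer (no l≢j) = c-cong (coords⇒≈ (lay-vertex _ _ _)
                            (trans (idx-vertex _ _ _) (swapAt-elsewhere a b (idx u) l≢j)))
      by-layer (yes l≡j) = by-index (transpose-cases a b (idx u))
        where
        lσ : lay σu ≡ j
        lσ = trans (lay-vertex _ _ _) l≡j
        by-index : TransposeCases a b (idx u) → c σu ≡ c u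
        by-index (inj₁ (x≡a , to-b)) =
          trans (at-j σu lσ (trans (idx-swap j a b u l≡j) to-b)) (trans (sym same) (sym (at-j u l≡j x≡a)))
        by-index (inj₂ (inj₁ (x≡b , to-a))) =
          trans (at-j σu lσ (trans (idx-swap j a b u l≡j) to-a)) (trans same (sym (at-j u l≡j x≡b)))
        by-index (inj₂ (inj₂ fixed)) =
          c-cong (coords⇒≈ (lay-vertex _ _ _) (trans (idx-swap j a b u l≡j) fixed))

    distinguishing⇒layer-injective : ∀ {m} (D : Distinguishable G m) j (q : In j) →
                                     Injective _≡_ _≡_ (λ a → proj₁ D (vertex j q a))
    distinguishing⇒layer-injective (c , c-cong , rigid) j q {a} {b} same with a F.≟ b
    ... | yes a≡b = a≡b
    ... | no a≢b = ⊥-elim (a≢b (sym b≡a))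
      where
      v : V G
      v = vertex j q a
      σ : Aut G
      σ = layerwise (swapAt j a b)
      b≡a : b ≡ a
      b≡a = begin
        b                                         ≡⟨ transpose-moves a b ⟨
        Transposition.transpose a b a             ≡⟨ cong (Transposition.transpose a b) (idx-vertex j q a) ⟨
        Transposition.transpose a b (idx v)       ≡⟨ idx-swap j a b v (lay-vertex j q a) ⟨
        idx (fun σ v)                             ≡⟨ ≈⇒idx (rigid σ (swap-preserves c c-cong j q a b same) v) ⟩
        idx v                                     ≡⟨ idx-vertex j q a ⟩
        a                                         ∎
        where open ≡-Reasoning

    distinguishing⇒k≤ : ∀ {m j} → In j → Distinguishable G m → k ≤ m
    distinguishing⇒k≤ {j = j} q D = FP.injective⇒≤ (distinguishing⇒layer-injective D j q)

  Γ-view : LayeredView Γ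
  Γ-view = record
    { In = λ _ → ⊤ ; lay = proj₁ ; idx = proj₂ ; lay-In = λ _ → tt ; vertex = λ j _ a → (j , a)
    ; lay-vertex = λ _ _ _ → refl ; idx-vertex = λ _ _ _ → refl ; ≈⇒lay = cong proj₁ ; ≈⇒idx = cong proj₂
    ; coords⇒≈ = cong₂ _,_ ; adj⇒LAdj = λ a → a ; LAdj⇒adj = λ a → a }

  -- Separation in ℤ: j - 1 separates j from j + 1 and j + 2; otherwise
  -- j + 1 separates j from j′.
  Γ-separated : Layered.Separated Γ-view
  Γ-separated j j′ _ _ j≢j′ with j′ ℤ.≟ sucℤ j
  ... | yes e = predℤ j , tt , pred-i≢i {j} , (λ x → suc-i≢pred-i {j} (sym (trans x e))) ,
                inj₁ (inj₂ (sym (ℤP.suc-pred j)) , λ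
                  { (inj₁ p) → pred-i≢i+2 j (trans p (cong sucℤ e))
                  ; (inj₂ p) → pred-i≢i {j} (sym (sucℤ-injective (trans (sym e) p))) })
  ... | no j′≢j+1 with j′ ℤ.≟ sucℤ (sucℤ j)
  ... | yes e = predℤ j , tt , pred-i≢i {j} , (λ x → pred-i≢i+2 j (trans x e)) ,
                inj₁ (inj₂ (sym (ℤP.suc-pred j)) , λ
                  { (inj₁ p) → pred-i≢i+3 j (trans p (cong sucℤ e))
                  ; (inj₂ p) → j≢j′ (sym (trans p (ℤP.suc-pred j))) })
  ... | no j′≢j+2 = sucℤ j , tt , (λ x → ℤP.i≢suc[i] {j} (sym x)) , (λ x → j′≢j+1 (sym x)) ,
                    inj₁ (inj₁ refl , λ { (inj₁ p) → j≢j′ (sucℤ-injective p) ; (inj₂ p) → j′≢j+2 p })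

  Γ-colour : ℤ × Fin k → Fin (suc k)
  Γ-colour (j , a) with j ℤ.≟ 0ℤ
  ... | yes _ = F.suc a
  ... | no _ = F.inject₁ a

  Γ-colour-injective : ∀ j a b → Γ-colour (j , a) ≡ Γ-colour (j , b) → a ≡ b
  Γ-colour-injective j a b e with j ℤ.≟ 0ℤ
  ... | yes _ = FP.suc-injective e
  ... | no _ = FP.inject₁-injective e

  Γ-colour-top : ∀ j a → Γ-colour (j , a) ≡ F.fromℕ k → j ≡ 0ℤ
  Γ-colour-top j a e with j ℤ.≟ 0ℤ
  ... | yes j≡0 = j≡0
  ... | no _ = ⊥-elim (FP.fromℕ≢inject₁ (sym e))

  -- An automorphism preserving Γ-colour fixes the top-coloured vertex,
  -- hence (by twins) layer 0, hence every layer by propagation.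
  Γ-colour-rigid : (σ : Aut Γ) → (∀ v → Γ-colour (fun σ v) ≡ Γ-colour v) → ∀ v → fun σ v ≡ v
  Γ-colour-rigid σ pres v = ℤ-induction (Fixed σ) fixed-0 up down (proj₁ v) v refl
    where
    open Layered Γ-view
    open GraphFacts Γ
    c-inj : ∀ {u v : ℤ × Fin k} → proj₁ u ≡ proj₁ v → Γ-colour u ≡ Γ-colour v → proj₂ u ≡ proj₂ v
    c-inj {u} {v} e c = Γ-colour-injective (proj₁ u) _ _ (trans c (cong (λ z → Γ-colour (z , proj₂ v)) (sym e)))
    top : ℤ × Fin k
    top = (0ℤ , F.fromℕ (suc k′))
    top-fixed : fun σ top ≡ top
    top-fixed = cong₂ _,_ layer-0 (c-inj layer-0 (pres top))
      where
      layer-0 : proj₁ (fun σ top) ≡ 0ℤ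
      layer-0 = Γ-colour-top _ _ (pres top)
    fixed-0 : Fixed σ 0ℤ
    fixed-0 u lu = cong₂ _,_ same-layer (c-inj same-layer (pres u))
      where
      same-layer : proj₁ (fun σ u) ≡ proj₁ u
      same-layer = trans (twins⇒same-layer Γ-separated (twins-preserved σ (same-layer⇒twins {u} {top} lu)))
                         (trans (cong proj₁ top-fixed) (sym lu))
    up : ∀ j → Fixed σ j → Fixed σ (sucℤ j)
    up j = fixed-propagates σ Γ-separated Γ-colour pres c-inj {j} tt (inj₁ refl) (lab-neighbours j)
             (λ l a → LayerAdj-cases a)
    down : ∀ j → Fixed σ j → Fixed σ (predℤ j)
    down j = fixed-propagates σ Γ-separated Γ-colour pres c-inj {j} tt (inj₂ (sym (ℤP.suc-pred j)))
               (λ e → lab-neighbours j (sym e)) (λ l a → Sum.swap (LayerAdj-cases a))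

  -- Let c be a k-colouring injective on every layer, hence bijective on
  -- every layer.  Re-indexing layer j + 4 so that it carries the colours of
  -- layer j turns translation by 4 into an automorphism preserving c.
  module TranslationByFour (c : ℤ × Fin k → Fin k)
                           (c-inj : ∀ j → Injective _≡_ _≡_ (λ a → c (j , a))) where
    with-colour : ∀ j y → Σ (Fin k) λ a → c (j , a) ≡ y
    with-colour j = injective-endo-onto (λ a → c (j , a)) (c-inj j)

    same-colour⇒same-index : ∀ {j j′ a a′} → j′ ≡ j → c (j′ , a′) ≡ c (j , a) → a′ ≡ a
    same-colour⇒same-index refl = c-inj _

    fwd bwd : ℤ → Fin k → Fin k
    fwd j a = proj₁ (with-colour (shift j) (c (j , a)))
    bwd j a = proj₁ (with-colour (unshift j) (c (j , a)))

    fwd-colour : ∀ j a → c (shift j , fwd j a) ≡ c (j , a)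
    fwd-colour j a = proj₂ (with-colour (shift j) (c (j , a)))

    bwd-colour : ∀ j a → c (unshift j , bwd j a) ≡ c (j , a)
    bwd-colour j a = proj₂ (with-colour (unshift j) (c (j , a)))

    -- Translation preserves adjacency: lab has period 4, and fwd j is
    -- injective on each layer.
    shift-LAdj : ∀ {i a j b} → LAdj i a j b → LAdj (shift i) (fwd i a) (shift j) (fwd j b)
    shift-LAdj {i} (inj₁ p) = inj₁ (trans (cong shift p) (shift-suc i))
    shift-LAdj {j = j} (inj₂ (inj₁ p)) = inj₂ (inj₁ (trans (cong shift p) (shift-suc j)))
    shift-LAdj {i} {a} {j} {b} (inj₂ (inj₂ (p , a≢b , clique))) = inj₂ (inj₂ (cong shift p ,
      (λ e → a≢b (same-colour⇒same-index p
                    (trans (sym (fwd-colour i a)) (trans (cong₂ (λ x y → c (x , y)) (cong shift p) e) (fwd-colour j b))))) ,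
      trans (lab-+4 i) clique))

    unshift-LAdj : ∀ {i a j b} → LAdj (shift i) (fwd i a) (shift j) (fwd j b) → LAdj i a j b
    unshift-LAdj {i} (inj₁ p) = inj₁ (shift-injective (trans p (sym (shift-suc i))))
    unshift-LAdj {j = j} (inj₂ (inj₁ p)) = inj₂ (inj₁ (shift-injective (trans p (sym (shift-suc j)))))
    unshift-LAdj {i} (inj₂ (inj₂ (p , ne , clique))) =
      inj₂ (inj₂ (shift-injective p , (λ e → ne (cong₂ fwd (shift-injective p) e)) , trans (sym (lab-+4 i)) clique))

    translation : Aut Γ
    translation = record
      { fun = λ u → (shift (proj₁ u) , fwd (proj₁ u) (proj₂ u))
      ; inv = λ u → (unshift (proj₁ u) , bwd (proj₁ u) (proj₂ u))
      ; fun-cong = λ { refl → refl }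
      ; inv-cong = λ { refl → refl }
      ; fun-inv = λ v → cong₂ _,_ (shift-unshift (proj₁ v))
          (same-colour⇒same-index (shift-unshift (proj₁ v)) (trans (fwd-colour _ _) (bwd-colour _ _)))
      ; inv-fun = λ v → cong₂ _,_ (unshift-shift (proj₁ v))
          (same-colour⇒same-index (unshift-shift (proj₁ v)) (trans (bwd-colour _ _) (fwd-colour _ _)))
      ; adj-pres = λ u v → shift-LAdj
      ; adj-refl = λ u v → unshift-LAdj
      }

    translation-preserves : ∀ v → c (fun translation v) ≡ c v
    translation-preserves (j , a) = fwd-colour j a

  -- D(Γ) > k: a distinguishing k-colouring is injective on layers, so the
  -- translation above would preserve it, yet it moves every vertex.
  Γ-not-k-distinguishable : ¬ Distinguishable Γ k
  Γ-not-k-distinguishable D@(c , c-cong , rigid) =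
    shift-0≢0 (cong proj₁ (rigid translation translation-preserves (0ℤ , F.zero)))
    where
    open TranslationByFour c (λ j → Layered.distinguishing⇒layer-injective Γ-view D j tt)
    shift-0≢0 : shift 0ℤ ≢ 0ℤ
    shift-0≢0 ()

  Γ-distinguishing-number : HasDistinguishingNumber Γ (suc k)
  Γ-distinguishing-number =
    distinguishing-number (Γ-colour , cong Γ-colour , Γ-colour-rigid) Γ-not-k-distinguishable

  walk-up : ∀ s (l : ℤ) (a b : Fin k) → WalkLen Γ (l , a) (+ (suc s) ℤ.+ l , b) (suc s)
  walk-up zero l a b = (1ℤ ℤ.+ l , b) , inj₁ refl , refl
  walk-up (suc s) l a b = (1ℤ ℤ.+ l , b) , inj₁ refl ,
    subst (λ z → WalkLen Γ (1ℤ ℤ.+ l , b) (z , b) (suc s)) (regroup (+ s) l) (walk-up s (1ℤ ℤ.+ l) b b)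
    where
    regroup : ∀ x y → (1ℤ ℤ.+ x) ℤ.+ (1ℤ ℤ.+ y) ≡ (1ℤ ℤ.+ (1ℤ ℤ.+ x)) ℤ.+ y
    regroup = solve-∀

  walk-down : ∀ s (l : ℤ) (a b : Fin k) → WalkLen Γ (l , a) (-[1+ s ] ℤ.+ l , b) (suc s)
  walk-down zero l a b = (-1ℤ ℤ.+ l , b) , inj₂ (inj₁ (sym (ℤP.suc-pred l))) , refl
  walk-down (suc s) l a b = (-1ℤ ℤ.+ l , b) , inj₂ (inj₁ (sym (ℤP.suc-pred l))) ,
    subst (λ z → WalkLen Γ (-1ℤ ℤ.+ l , b) (z , b) (suc s)) (regroup (-[1+ s ]) l) (walk-down s (-1ℤ ℤ.+ l) b b)
    where
    regroup : ∀ x y → x ℤ.+ (-1ℤ ℤ.+ y) ≡ (-1ℤ ℤ.+ x) ℤ.+ y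
    regroup = solve-∀

  walk-within : ∀ (l : ℤ) (a b : Fin k) → WalkLen Γ (l , a) (l , b) 2
  walk-within l a b = (1ℤ ℤ.+ l , b) , inj₁ refl , ((l , b) , inj₂ (inj₁ refl) , refl)

  Γ-connected : Connected Γ
  Γ-connected (i , a) (j , b) = by-difference (j ℤ.- i) (split j i)
    where
    split : ∀ x y → x ≡ (x ℤ.- y) ℤ.+ y
    split = solve-∀
    by-difference : ∀ d → j ≡ d ℤ.+ i → Σ ℕ λ m → WalkLen Γ (i , a) (j , b) m
    by-difference (+ zero) e =
      2 , subst (λ z → WalkLen Γ (i , a) (z , b) 2) (sym (trans e (ℤP.+-identityˡ i))) (walk-within i a b)
    by-difference (+ suc s) e = suc s , subst (λ z → WalkLen Γ (i , a) (z , b) (suc s)) (sym e) (walk-up s i a b)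
    by-difference -[1+ s ] e = suc s , subst (λ z → WalkLen Γ (i , a) (z , b) (suc s)) (sym e) (walk-down s i a b)

  -- A finite list of vertices misses the layer beyond the sum of the
  -- absolute values of its layers.
  Γ-infinite : Infinite Γ
  Γ-infinite (l , covers) = misses (size l) l ℕP.≤-refl (covers (+ suc (size l) , F.zero))
    where
    size : List (ℤ × Fin k) → ℕ
    size [] = 0
    size (u ∷ l) = ℤ.∣ proj₁ u ∣ ℕ.+ size l
    misses : ∀ B l → size l ℕ.≤ B → ¬ Any (λ y → (+ suc B , F.zero) ≡ y) l
    misses B (u ∷ l) le (here refl) = ℕP.1+n≰n (ℕP.≤-trans (ℕP.m≤m+n _ _) le)
    misses B (u ∷ l) le (there a) = misses B l (ℕP.≤-trans (ℕP.m≤n+m _ _) le) a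

  LAdj? : ∀ i a j b → Dec (LAdj i a j b)
  LAdj? i a j b = (j ℤ.≟ sucℤ i) ⊎-dec (i ℤ.≟ sucℤ j) ⊎-dec
                  (i ℤ.≟ j) ×-dec ¬? (a F.≟ b) ×-dec (lab i Bool.≟ true)

  Γ-locally-finite : LocallyFinite Γ
  Γ-locally-finite (i , a) = neighbours , λ w → listed w , (λ m → proj₂ (∈-filter⁻ adjacent? {xs = candidates} m))
    where
    adjacent? : ∀ w → Dec (LAdj i a (proj₁ w) (proj₂ w))
    adjacent? w = LAdj? i a (proj₁ w) (proj₂ w)
    candidates neighbours : List (ℤ × Fin k)
    candidates = cartesianProduct (sucℤ i ∷ predℤ i ∷ i ∷ []) (allFin k)
    neighbours = filter adjacent? candidates
    nearby-layer : ∀ {j b} → LAdj i a j b → j ∈ (sucℤ i ∷ predℤ i ∷ i ∷ [])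
    nearby-layer (inj₁ p) = here p
    nearby-layer {j} (inj₂ (inj₁ p)) = there (here (trans (sym (ℤP.pred-suc j)) (cong predℤ (sym p))))
    nearby-layer (inj₂ (inj₂ (p , _))) = there (there (here (sym p)))
    listed : ∀ w → LAdj i a (proj₁ w) (proj₂ w) → w ∈ neighbours
    listed (j , b) adj = ∈-filter⁺ adjacent? (∈-cartesianProduct⁺ (nearby-layer adj) (∈-allFin b)) adj

  two-more : ∀ {t m} → t ≤ m ℕ.+ m → suc (suc t) ≤ suc m ℕ.+ suc m
  two-more {t} {m} le = s≤s (subst (suc t ≤_) (sym (ℕP.+-suc m m)) (s≤s le))

  walk-span : ∀ m (u v : ℤ × Fin k) → WalkLen Γ u v m →
              Σ ℕ λ t → t ≤ m ℕ.+ m × proj₁ v ≡ (proj₁ u ℤ.- + m) ℤ.+ + t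
  walk-span zero u v refl = 0 , z≤n , no-move (proj₁ u)
    where
    no-move : ∀ x → x ≡ (x ℤ.- 0ℤ) ℤ.+ 0ℤ
    no-move = solve-∀
  walk-span (suc m) u v (w , u~w , rest) with walk-span m w v rest | u~w
  ... | t , t≤2m , eq | inj₁ up =
    suc (suc t) , two-more t≤2m ,
    trans eq (trans (cong (λ z → (z ℤ.- + m) ℤ.+ + t) up) (regroup (proj₁ u) (+ m) (+ t)))
    where
    regroup : ∀ x M T → ((1ℤ ℤ.+ x) ℤ.- M) ℤ.+ T ≡ (x ℤ.- (1ℤ ℤ.+ M)) ℤ.+ (1ℤ ℤ.+ (1ℤ ℤ.+ T))
    regroup = solve-∀
  ... | t , t≤2m , eq | inj₂ (inj₁ down) =
    t , ℕP.≤-trans t≤2m (ℕP.≤-trans (ℕP.n≤1+n _) (ℕP.≤-trans (ℕP.n≤1+n _) (two-more ℕP.≤-refl))) ,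
    trans eq (trans (regroup (proj₁ w) (+ m) (+ t)) (cong (λ z → (z ℤ.- + suc m) ℤ.+ + t) (sym down)))
    where
    regroup : ∀ y M T → (y ℤ.- M) ℤ.+ T ≡ ((1ℤ ℤ.+ y) ℤ.- (1ℤ ℤ.+ M)) ℤ.+ T
    regroup = solve-∀
  ... | t , t≤2m , eq | inj₂ (inj₂ (same , _)) =
    suc t , ℕP.≤-trans (s≤s t≤2m) (ℕP.≤-trans (ℕP.n≤1+n _) (two-more ℕP.≤-refl)) ,
    trans eq (trans (cong (λ z → (z ℤ.- + m) ℤ.+ + t) (sym same)) (regroup (proj₁ u) (+ m) (+ t)))
    where
    regroup : ∀ x M T → (x ℤ.- M) ℤ.+ T ≡ (x ℤ.- (1ℤ ℤ.+ M)) ℤ.+ (1ℤ ℤ.+ T)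
    regroup = solve-∀

  reach : ∀ (i : ℤ) (a₀ a : Fin k) (n t : ℕ) → t ≤ n ℕ.+ n → 2 ≤ n →
          DistLE Γ (i , a₀) ((i ℤ.- + n) ℤ.+ + t , a) n
  reach i a₀ a n t t≤2n 2≤n with ℕ.compare t n
  ... | ℕ.less t s = suc s , s≤s (ℕP.m≤n+m s t) ,
    subst (λ z → WalkLen Γ (i , a₀) (z , a) (suc s)) (regroup i (+ t) (+ s)) (walk-down s i a₀ a)
    where
    regroup : ∀ x T S → (ℤ.- (1ℤ ℤ.+ S)) ℤ.+ x ≡ (x ℤ.- (1ℤ ℤ.+ (T ℤ.+ S))) ℤ.+ T
    regroup = solve-∀
  ... | ℕ.equal t = 2 , 2≤n ,
    subst (λ z → WalkLen Γ (i , a₀) (z , a) 2) (regroup i (+ t)) (walk-within i a₀ a)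
    where
    regroup : ∀ x T → x ≡ (x ℤ.- T) ℤ.+ T
    regroup = solve-∀
  ... | ℕ.greater n s = suc s , ℕP.+-cancelˡ-≤ n _ _ (subst (_≤ n ℕ.+ n) (sym (ℕP.+-suc n s)) t≤2n) ,
    subst (λ z → WalkLen Γ (i , a₀) (z , a) (suc s)) (regroup i (+ n) (+ s)) (walk-up s i a₀ a)
    where
    regroup : ∀ x N S → (1ℤ ℤ.+ S) ℤ.+ x ≡ (x ℤ.- N) ℤ.+ (1ℤ ℤ.+ (N ℤ.+ S))
    regroup = solve-∀

  -- The ball of radius n ≥ 2 around (i , a₀) is the window of layers
  -- e = i - n , … , f = i + n of Γ.
  module BallWindow (i : ℤ) (a₀ : Fin k) (n : ℕ) (2≤n : 2 ≤ n) where
    B : Graph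
    B = Ball Γ (i , a₀) n

    e : ℤ
    e = i ℤ.- + n

    layer : ℕ → ℤ
    layer t = e ℤ.+ + t

    f : ℤ
    f = layer (n ℕ.+ n)

    InWindow : ℤ → Set
    InWindow j = Σ ℕ λ t → t ≤ n ℕ.+ n × j ≡ layer t

    in-window : ∀ {y} → DistLE Γ (i , a₀) y n → InWindow (proj₁ y)
    in-window {y} (m , m≤n , walk) with walk-span m (i , a₀) y walk
    ... | t , t≤2m , eq = r ℕ.+ t , bound ,
          trans eq (trans (regroup i (+ m) (+ r) (+ t)) (cong (λ z → (i ℤ.- + z) ℤ.+ + (r ℕ.+ t)) m+r≡n))
      where
      r : ℕ
      r = n ℕ.∸ m
      m+r≡n : m ℕ.+ r ≡ n
      m+r≡n = ℕP.m+[n∸m]≡n m≤n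
      regroup : ∀ x M R T → (x ℤ.- M) ℤ.+ T ≡ (x ℤ.- (M ℤ.+ R)) ℤ.+ (R ℤ.+ T)
      regroup = solve-∀
      bound : r ℕ.+ t ≤ n ℕ.+ n
      bound = subst (λ z → r ℕ.+ t ≤ z ℕ.+ z) m+r≡n
        (ℕP.≤-trans (ℕP.+-monoʳ-≤ r t≤2m)
          (ℕP.≤-trans (ℕP.m≤m+n (r ℕ.+ (m ℕ.+ m)) r) (ℕP.≤-reflexive (rearrange m r))))
        where
        rearrange : ∀ m r → (r ℕ.+ (m ℕ.+ m)) ℕ.+ r ≡ (m ℕ.+ r) ℕ.+ (m ℕ.+ r)
        rearrange = ℕSolver.solve-∀

    -- B is the layered view of the window (reach gives whole layers).
    B-view : LayeredView B
    B-view = record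
      { In = InWindow ; lay = λ v → proj₁ (proj₁ v) ; idx = λ v → proj₂ (proj₁ v)
      ; lay-In = λ v → in-window (proj₂ v)
      ; vertex = λ j q a → (j , a) , subst (λ z → DistLE Γ (i , a₀) (z , a) n) (sym (proj₂ (proj₂ q)))
                                       (reach i a₀ a n (proj₁ q) (proj₁ (proj₂ q)) 2≤n)
      ; lay-vertex = λ _ _ _ → refl ; idx-vertex = λ _ _ _ → refl
      ; ≈⇒lay = cong proj₁ ; ≈⇒idx = cong proj₂ ; coords⇒≈ = cong₂ _,_
      ; adj⇒LAdj = λ a → a ; LAdj⇒adj = λ a → a }

    layer-injective : ∀ {s t} → layer s ≡ layer t → s ≡ t
    layer-injective eq = ℤP.+-injective (+-cancelˡ {e} eq)

    layer-suc : ∀ t → sucℤ (layer t) ≡ layer (suc t)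
    layer-suc t = regroup e (+ t)
      where
      regroup : ∀ E T → 1ℤ ℤ.+ (E ℤ.+ T) ≡ E ℤ.+ (1ℤ ℤ.+ T)
      regroup = solve-∀

    layer-pred : ∀ t → predℤ (layer (suc t)) ≡ layer t
    layer-pred t = trans (cong predℤ (sym (layer-suc t))) (ℤP.pred-suc (layer t))

    layer-0 : layer 0 ≡ e
    layer-0 = ℤP.+-identityʳ e

    4≤2n : 4 ≤ n ℕ.+ n
    4≤2n = ℕP.+-mono-≤ 2≤n 2≤n

    e-in : InWindow e
    e-in = 0 , z≤n , sym layer-0

    below-e-out : ¬ InWindow (predℤ e)
    below-e-out (t , _ , eq) = diff≢ (+ suc t) (gap e (+ t)) (λ ()) (sym eq)
      where
      gap : ∀ E T → (E ℤ.+ T) ℤ.- (-1ℤ ℤ.+ E) ≡ 1ℤ ℤ.+ T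
      gap = solve-∀

    above-f-out : ¬ InWindow (sucℤ f)
    above-f-out (t , t≤2n , eq) =
      ℕP.1+n≰n (subst (_≤ n ℕ.+ n) (sym (layer-injective (trans (sym (layer-suc (n ℕ.+ n))) eq))) t≤2n)

    bottom-top-or-interior : ∀ t → t ≤ n ℕ.+ n →
      t ≡ 0 ⊎ t ≡ n ℕ.+ n ⊎ (InWindow (predℤ (layer t)) × InWindow (sucℤ (layer t)))
    bottom-top-or-interior zero _ = inj₁ refl
    bottom-top-or-interior (suc t) le with suc t ℕ.≟ n ℕ.+ n
    ... | yes top = inj₂ (inj₁ top)
    ... | no ¬top = inj₂ (inj₂ ((t , ℕP.≤-trans (ℕP.n≤1+n t) le , layer-pred t) ,
                               (suc (suc t) , ℕP.≤∧≢⇒< le ¬top , layer-suc (suc t))))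

    -- Separation in the window comes from separation in the path 0 … 2n.
    B-separated : Layered.Separated B-view
    B-separated j j′ (t , t≤ , eq) (t′ , t′≤ , eq′) j≢j′
      with path-separated (n ℕ.+ n) 4≤2n t t′ t≤ t′≤ (λ p → j≢j′ (trans eq (trans (cong layer p) (sym eq′))))
    ... | s , s≤ , s≢t , s≢t′ , sep =
      layer s , (s , s≤ , refl) , (λ p → s≢t (layer-injective (trans p eq))) ,
      (λ p → s≢t′ (layer-injective (trans p eq′))) , convert sep
      where
      to-layers : ∀ {s t} → AdjPath s t → LayerAdj (layer s) (layer t)
      to-layers {s} {t} (inj₁ p) = inj₁ (trans (cong layer p) (sym (layer-suc t)))
      to-layers {s} {t} (inj₂ p) = inj₂ (trans (cong layer p) (sym (layer-suc s)))
      from-layers : ∀ {s t} → LayerAdj (layer s) (layer t) → AdjPath s t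
      from-layers {s} {t} (inj₁ p) = inj₁ (layer-injective (trans p (layer-suc t)))
      from-layers {s} {t} (inj₂ p) = inj₂ (layer-injective (trans p (layer-suc s)))
      convert : SeparatesPath s t t′ →
                (LayerAdj (layer s) j × ¬ LayerAdj (layer s) j′) ⊎ (LayerAdj (layer s) j′ × ¬ LayerAdj (layer s) j)
      convert (inj₁ (adj , ¬adj)) = inj₁ (subst (LayerAdj (layer s)) (sym eq) (to-layers adj) ,
                                          λ h → ¬adj (from-layers (subst (LayerAdj (layer s)) eq′ h)))
      convert (inj₂ (adj , ¬adj)) = inj₂ (subst (LayerAdj (layer s)) (sym eq′) (to-layers adj) ,
                                          λ h → ¬adj (from-layers (subst (LayerAdj (layer s)) eq h)))

    -- Near the two ends of the window some labels disagree: lab e ≠ lab f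
    -- when n is odd, lab (e + 1) ≠ lab (f - 1) when n is even.
    ends-differ : lab e ≢ lab f ⊎ lab (sucℤ e) ≢ lab (predℤ f)
    ends-differ with parity n
    ... | m , inj₂ odd = inj₁ λ same → not≢ (lab e) (sym (trans same (trans (cong (λ z → lab (e ℤ.+ + z)) 2n≡4m+2)
                                                                             (lab-+4m+2 m e))))
      where
      2n≡4m+2 : n ℕ.+ n ≡ suc (suc (m ℕ.* 4))
      2n≡4m+2 = trans (cong₂ ℕ._+_ odd odd) (double m)
        where
        double : ∀ m → (1 ℕ.+ (m ℕ.+ m)) ℕ.+ (1 ℕ.+ (m ℕ.+ m)) ≡ 2 ℕ.+ m ℕ.* 4
        double = ℕSolver.solve-∀
    ... | zero , inj₁ even = ⊥-elim (ℕP.1+n≰n (ℕP.≤-trans (subst (2 ≤_) even 2≤n) z≤n))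
    ... | suc m , inj₁ even = inj₂ λ same → not≢ (lab (sucℤ e)) (sym (trans same (trans (cong lab f-1≡)
                                                                                      (lab-+4m+2 m (sucℤ e)))))
      where
      2n≡4m+4 : n ℕ.+ n ≡ 4 ℕ.+ m ℕ.* 4
      2n≡4m+4 = trans (cong₂ ℕ._+_ even even) (double m)
        where
        double : ∀ m → (1 ℕ.+ m ℕ.+ (1 ℕ.+ m)) ℕ.+ (1 ℕ.+ m ℕ.+ (1 ℕ.+ m)) ≡ 4 ℕ.+ m ℕ.* 4
        double = ℕSolver.solve-∀
      f-1≡ : predℤ f ≡ sucℤ e ℤ.+ + (suc (suc (m ℕ.* 4)))
      f-1≡ = trans (cong (λ z → predℤ (e ℤ.+ + z)) 2n≡4m+4) (regroup e (+ (m ℕ.* 4)))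
        where
        regroup : ∀ E Q → -1ℤ ℤ.+ (E ℤ.+ (1ℤ ℤ.+ (1ℤ ℤ.+ (1ℤ ℤ.+ (1ℤ ℤ.+ Q)))))
                        ≡ (1ℤ ℤ.+ E) ℤ.+ (1ℤ ℤ.+ (1ℤ ℤ.+ Q))
        regroup = solve-∀

    module Rigidity (σ : Aut B) (pres : ∀ v → proj₂ (proj₁ (fun σ v)) ≡ proj₂ (proj₁ v)) where
      open LayeredView B-view
      open Layered B-view
      open GraphFacts B

      bottom : Fin k → V B
      bottom = vertex e e-in

      bottom-layer-moves-together : ∀ u → lay u ≡ e → lay (fun σ u) ≡ lay (fun σ (bottom F.zero))
      bottom-layer-moves-together u lu =
        twins⇒same-layer B-separated {fun σ u} {fun σ (bottom F.zero)}
          (twins-preserved σ (same-layer⇒twins {u} {bottom F.zero} lu))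

      unmoved : lay (fun σ (bottom F.zero)) ≡ e → ∀ v → fun σ v ≈G v
      unmoved stays v = fixed-up-to (proj₁ (lay-In v)) (proj₁ (proj₂ (lay-In v))) v (proj₂ (proj₂ (lay-In v)))
        where
        fixed-e : Fixed σ e
        fixed-e u lu = coords⇒≈ {fun σ u} {u} (trans (bottom-layer-moves-together u lu) (trans stays (sym lu))) (pres u)
        fixed-up-to : ∀ t → t ≤ n ℕ.+ n → Fixed σ (layer t)
        fixed-up-to zero _ = subst (Fixed σ) (sym layer-0) fixed-e
        fixed-up-to (suc t) le = subst (Fixed σ) (layer-suc t)
          (fixed-propagates σ B-separated idx pres (λ _ c → c) {layer t} (t , t≤ , refl) (inj₁ refl)
            (lab-neighbours (layer t)) (λ l a → LayerAdj-cases a) (fixed-up-to t t≤))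
          where
          t≤ : t ≤ n ℕ.+ n
          t≤ = ℕP.≤-trans (ℕP.n≤1+n t) le

      label-moves : ∀ {j j′} (q : InWindow j) → (∀ u → lay u ≡ j → lay (fun σ u) ≡ j′) → lab j ≡ lab j′
      label-moves {j} q moves =
        trans (label-preserved σ {vertex j q F.zero} {vertex j q (F.suc F.zero)} refl (λ ())
                 (trans (moves _ refl) (sym (moves _ refl))))
              (cong lab (moves _ refl))

      -- Layer e cannot go to the other end f: then e + 1 would go to f - 1
      -- (f + 1 is outside), and labels near the two ends differ.
      not-reversed : lay (fun σ (bottom F.zero)) ≢ f
      not-reversed to-f = Sum.[ (λ ne → ne (label-moves e-in e↦f)) , (λ ne → ne (label-moves e+1-in e+1↦f-1)) ]
                            ends-differ
        where
        e↦f : ∀ u → lay u ≡ e → lay (fun σ u) ≡ f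
        e↦f u lu = trans (bottom-layer-moves-together u lu) to-f
        e-onto-f : MapsOnto σ e f
        e-onto-f q a = bottom a , refl , coords⇒≈ {fun σ (bottom a)} {vertex f q a} (e↦f (bottom a) refl) (pres _)
        e+1-in : InWindow (sucℤ e)
        e+1-in = 1 , ℕP.≤-trans (s≤s z≤n) 4≤2n , trans (cong sucℤ (sym layer-0)) (layer-suc 0)
        e+1↦f-1 : ∀ u → lay u ≡ sucℤ e → lay (fun σ u) ≡ predℤ f
        e+1↦f-1 u lu with image-beside σ e-onto-f {u} {bottom F.zero} (λ (p : lay u ≡ e) → ℤP.i≢suc[i] (trans (sym p) lu))
                                        (LAdj⇒adj {u} {bottom F.zero} (LayerAdj⇒LAdj (inj₂ lu))) refl to-f
        ... | inj₁ above-f = ⊥-elim (above-f-out (subst InWindow above-f (lay-In (fun σ u))))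
        ... | inj₂ below-f = trans (sym (ℤP.pred-suc _)) (cong predℤ (sym below-f))

      -- σ (bottom 0) is end-like, so it lies in layer e or f; f is excluded.
      rigid : ∀ v → fun σ v ≈G v
      rigid with lay-In (fun σ (bottom F.zero))
      ... | t , t≤ , eq with bottom-top-or-interior t t≤
      ... | inj₁ t≡0 = unmoved (trans eq (trans (cong layer t≡0) layer-0))
      ... | inj₂ (inj₁ t≡top) = ⊥-elim (not-reversed (trans eq (cong layer t≡top)))
      ... | inj₂ (inj₂ (below , above)) =
        ⊥-elim (interior-not-endLike B-separated {fun σ (bottom F.zero)} below above eq
                  (endLike-preserved σ (bottom-endLike {bottom F.zero} below-e-out)))

    ball-distinguishing-number : HasDistinguishingNumber B k
    ball-distinguishing-number = distinguishing-number
      ((λ v → proj₂ (proj₁ v)) , cong proj₂ , Rigidity.rigid)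
      (λ D → ℕP.1+n≰n (Layered.distinguishing⇒k≤ B-view e-in D))

corollary1p3 : ∀ (k : ℕ) → 3 ≤ k →
    Σ Graph λ Γ →
    Infinite Γ × LocallyFinite Γ × Connected Γ ×
    ¬ Distinguishable Γ k ×
    HasDistinguishingNumber Γ (suc k) ×
    ((x : V Γ) → Σ ℕ λ N → ∀ n → N ≤ n →
    HasDistinguishingNumber (Ball Γ x n) k)
corollary1p3 (suc (suc k′)) _ =
  Γ , Γ-infinite , Γ-locally-finite , Γ-connected , Γ-not-k-distinguishable , Γ-distinguishing-number ,
  λ { (i , a) → 2 , λ n 2≤n → BallWindow.ball-distinguishing-number i a n 2≤n }
  where open Construction k′
corollary1p3 (suc zero) (s≤s ())
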